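{- Let $T$ be a $2$-generalized star graph with $n$ nodes whose center has degree $\Delta$ (so $n=2\Delta+1$). Then $|E_{fix}(T)|\le F_{n-\lceil \Delta/2\rceil}$.
   Context: A star graph with $\Delta$ leaves is a tree consisting of a center node adjacent to $\Delta$ leaves; the $2$-generalized star graph is obtained by inserting one new node into each of its edges. For a tree $T=(V,E)$, $E_{fix}(T)$ is the set of all $F\subseteq E$ with $2deg_F(v)\le deg(v)$ for every $v\in V$, where $deg_F(v)$ is the number of edges of $F$ incident to $v$ and $deg(v)$ is the degree of $v$ in $T$. $F_i$ denotes the $i$-th Fibonacci number: $F_0=0$, $F_1=1$, $F_i=F_{i-1}+F_{i-2}$. -}

module Defs where

open import Data.Nat using (ℕ; zero; suc; _+_; _*_; _≤_; _≤?_)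
open import Data.Bool using (Bool; true; false; _∨_; _∧_; if_then_else_)
open import Data.Fin using (Fin; zero; suc; _↑ˡ_; _↑ʳ_)
open import Data.Fin.Properties using (_≟_; all?)
open import Data.Product using (_×_; _,_)
open import Data.Vec using (Vec; []; _∷_; map; allFin; _++_)
open import Data.List using (List; []; _∷_; length; filter) renaming (map to mapL; _++_ to _++L_)
open import Relation.Nullary.Decidable using (⌊_⌋; Dec)

fib : ℕ → ℕ
fib zero = 0
fib (suc zero) = 1
fib (suc (suc i)) = fib (suc i) + fib i

-- A (simple, undirected) graph on vertex set Fin n given by its list of m edges.
Edges : ℕ → ℕ → Set
Edges n m = Vec (Fin n × Fin n) m

incident : ∀ {n} → Fin n → Fin n × Fin n → Bool
incident v (a , b) = ⌊ v ≟ a ⌋ ∨ ⌊ v ≟ b ⌋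

-- An edge subset F ⊆ E, given as its characteristic vector over the m edges.
EdgeSubset : ℕ → Set
EdgeSubset m = Vec Bool m

degF : ∀ {n m} → Edges n m → EdgeSubset m → Fin n → ℕ
degF [] [] v = 0
degF (e ∷ E) (b ∷ F) v = (if b ∧ incident v e then 1 else 0) + degF E F v

full : ∀ m → EdgeSubset m
full zero = []
full (suc m) = true ∷ full m

deg : ∀ {n m} → Edges n m → Fin n → ℕ
deg {m = m} E v = degF E (full m) v

IsFix : ∀ {n m} → Edges n m → EdgeSubset m → Set
IsFix E F = ∀ v → 2 * degF E F v ≤ deg E v

isFix? : ∀ {n m} (E : Edges n m) (F : EdgeSubset m) → Dec (IsFix E F)
isFix? E F = all? (λ v → 2 * degF E F v ≤? deg E v)

allSubsets : ∀ m → List (EdgeSubset m)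
allSubsets zero = [] ∷ []
allSubsets (suc m) = mapL (true ∷_) (allSubsets m) ++L mapL (false ∷_) (allSubsets m)

numFix : ∀ {n m} → Edges n m → ℕ
numFix E = length (filter (isFix? E) (allSubsets _))

-- 2-generalized star with Δ leaves: n = 2Δ+1 vertices.
-- vertex 0 = center, vertex 1+i = subdivision node i, vertex 1+Δ+i = leaf i (i < Δ);
-- edges: center—mid i  and  mid i—leaf i.
center : ∀ Δ → Fin (suc (Δ + Δ))
center Δ = zero

mid : ∀ Δ → Fin Δ → Fin (suc (Δ + Δ))
mid Δ i = suc (i ↑ˡ Δ)

leaf : ∀ Δ → Fin Δ → Fin (suc (Δ + Δ))
leaf Δ i = suc (Δ ↑ʳ i)

genStar2 : ∀ Δ → Edges (suc (Δ + Δ)) (Δ + Δ)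
genStar2 Δ = map (λ i → (center Δ , mid Δ i)) (allFin Δ)
          ++ map (λ i → (mid Δ i , leaf Δ i)) (allFin Δ)

{-# OPTIONS --safe #-}
module Submission where

-- A leaf has degree 1, so a fixed edge set contains no leaf edge; the center
-- has degree Δ, so it contains at most ⌊Δ/2⌋ center edges. Hence |E_fix| is at
-- most the number N(k, c) of subsets of size ≤ c of a k-set, for k = Δ and
-- c = ⌊Δ/2⌋. Splitting on the first element gives N(k+1, c+1) = N(k, c) +
-- N(k, c+1), the Fibonacci recurrence in k + c, so N(k, c) ≤ F_{k+c+1}; and
-- (2Δ + 1) − ⌈Δ/2⌉ = Δ + ⌊Δ/2⌋ + 1.

open import Defs
open import Data.Bool using (true; false; _∧_; _∨_; if_then_else_)
open import Data.Bool.Properties using (∨-zeroʳ; ¬-not) renaming (_≟_ to _≟ᵇ_)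
open import Data.Empty using (⊥-elim)
open import Data.Fin using (Fin; zero; suc; _↑ˡ_; _↑ʳ_; splitAt)
open import Data.Fin.Properties using (_≟_; suc-injective; ↑ʳ-injective; splitAt-↑ˡ; splitAt-↑ʳ; all?)
open import Data.List using ([]; _∷_; length; filter) renaming (map to mapL; _++_ to _++L_)
open import Data.List.Properties using (filter-++; length-++; filter-none; length-filter)
open import Data.List.Relation.Binary.Sublist.Propositional using (⊆-reflexive)
open import Data.List.Relation.Binary.Sublist.Propositional.Properties using (filter⁺)
open import Data.List.Relation.Binary.Sublist.Heterogeneous.Properties using (length-mono-≤)
open import Data.List.Relation.Unary.All using (universal)
open import Data.Nat using (ℕ; zero; suc; _+_; _*_; _∸_; _≤_; _≤?_; z≤n; s≤s; s≤s⁻¹; ⌊_/2⌋; ⌈_/2⌉)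
open import Data.Nat.Properties
  using (≤-refl; ≤-reflexive; ≤-trans; module ≤-Reasoning; m≤m+n; m≤n+m; +-mono-≤; *-monoʳ-≤;
         +-comm; +-assoc; +-suc; +-identityʳ; m+n∸n≡m; ⌊n/2⌋-mono; n≡⌊n+n/2⌋; ⌊n/2⌋+⌈n/2⌉≡n)
open import Data.Nat.Tactic.RingSolver using (solve-∀)
open import Data.Product using (_×_; _,_; proj₂; map₁)
open import Data.Sum using (_⊎_; inj₁; inj₂; [_,_])
open import Data.Vec using ([]; _∷_; lookup; take; drop; map; allFin; _++_; countᵇ)
open import Data.Vec.Properties using (lookup-map; lookup-allFin; lookup-++ʳ; count≤n)
open import Function using (id; _∘_; case_of_)
open import Level using (0ℓ)
open import Relation.Binary.PropositionalEquality
  using (_≡_; _≢_; refl; sym; trans; cong; cong₂; subst; module ≡-Reasoning)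
open import Relation.Nullary using (¬_; yes; no; does)
open import Relation.Nullary.Decidable using (T?; _×-dec_)
open import Relation.Unary using (Pred; Decidable)

#subsets : ∀ m {P : Pred (EdgeSubset m) 0ℓ} → Decidable P → ℕ
#subsets m P? = length (filter P? (allSubsets m))

length-filter-map : ∀ {A B : Set} {P : Pred B 0ℓ} (P? : Decidable P) (f : A → B) xs →
  length (filter P? (mapL f xs)) ≡ length (filter (P? ∘ f) xs)
length-filter-map P? f [] = refl
length-filter-map P? f (x ∷ xs) with does (P? (f x))
... | true = cong suc (length-filter-map P? f xs)
... | false = length-filter-map P? f xs

module _ {m} {P : Pred (EdgeSubset m) 0ℓ} (P? : Decidable P) where

  #subsets-mono : ∀ {Q} (Q? : Decidable Q) → (∀ {v} → P v → Q v) → #subsets m P? ≤ #subsets m Q?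
  #subsets-mono Q? P⇒Q =
    length-mono-≤ (filter⁺ P? Q? (λ { refl → P⇒Q }) (⊆-reflexive {x = allSubsets m} refl))

  #subsets-empty : (∀ v → ¬ P v) → #subsets m P? ≡ 0
  #subsets-empty ¬P = cong length (filter-none P? (universal ¬P (allSubsets m)))

#subsets-suc : ∀ {m} {P : Pred (EdgeSubset (suc m)) 0ℓ} (P? : Decidable P) →
  #subsets (suc m) P? ≡ #subsets m (P? ∘ (true ∷_)) + #subsets m (P? ∘ (false ∷_))
#subsets-suc {m} P? = begin
  length (filter P? (ts ++L fs))                  ≡⟨ cong length (filter-++ P? ts fs) ⟩
  length (filter P? ts ++L filter P? fs)          ≡⟨ length-++ (filter P? ts) ⟩
  length (filter P? ts) + length (filter P? fs)   ≡⟨ cong₂ _+_ (length-filter-map P? (true ∷_) (allSubsets m))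
                                                                 (length-filter-map P? (false ∷_) (allSubsets m)) ⟩
  #subsets m (P? ∘ (true ∷_)) + #subsets m (P? ∘ (false ∷_)) ∎
  where
  open ≡-Reasoning
  ts = mapL (true ∷_) (allSubsets m)
  fs = mapL (false ∷_) (allSubsets m)

#subsets-allFalse : ∀ {m} {P : Pred (EdgeSubset m) 0ℓ} (P? : Decidable P) →
  (∀ {v} → P v → ∀ i → lookup v i ≡ false) → #subsets m P? ≤ 1
#subsets-allFalse {zero} P? _ = length-filter P? (allSubsets 0)
#subsets-allFalse {suc m} {P} P? allFalse = begin
  #subsets (suc m) P?                      ≡⟨ #subsets-suc P? ⟩
  #subsets m heads + #subsets m tails      ≡⟨ cong (_+ #subsets m tails) (#subsets-empty heads noTrueHead) ⟩
  #subsets m tails                         ≤⟨ #subsets-allFalse tails (λ p i → allFalse p (suc i)) ⟩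
  1                                        ∎
  where
  open ≤-Reasoning
  heads : Decidable (P ∘ (true ∷_))
  heads = P? ∘ (true ∷_)
  tails : Decidable (P ∘ (false ∷_))
  tails = P? ∘ (false ∷_)
  noTrueHead : ∀ v → ¬ P (true ∷ v)
  noTrueHead v p with () ← allFalse p zero

-- #subsets (k + D) (sparse? k c) counts the subsets of size at most c of a
-- k-set; the D trailing positions are forced to be empty.
Sparse : ∀ k {D} → ℕ → Pred (EdgeSubset (k + D)) 0ℓ
Sparse k c v = countᵇ id (take k v) ≤ c × (∀ i → lookup v (k ↑ʳ i) ≡ false)

sparse? : ∀ k {D} c → Decidable (Sparse k {D} c)
sparse? k c v = countᵇ id (take k v) ≤? c ×-dec all? (λ i → lookup v (k ↑ʳ i) ≟ᵇ false)

fib-pos : ∀ n → 1 ≤ fib (suc n)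
fib-pos zero = ≤-refl
fib-pos (suc n) = ≤-trans (fib-pos n) (m≤m+n _ _)

fib-≤-suc : ∀ n → fib n ≤ fib (suc n)
fib-≤-suc zero = z≤n
fib-≤-suc (suc n) = m≤m+n _ _

#sparse≤fib : ∀ k D c → #subsets (k + D) (sparse? k {D} c) ≤ fib (suc (k + c))
#sparse≤fib zero D c = ≤-trans (#subsets-allFalse (sparse? 0 {D} c) proj₂) (fib-pos c)
#sparse≤fib (suc k) D zero = begin
  #subsets (suc k + D) (sparse? (suc k) 0)         ≡⟨ #subsets-suc (sparse? (suc k) 0) ⟩
  #subsets (k + D) heads + #subsets (k + D) tails  ≡⟨ cong (_+ #subsets (k + D) tails)
                                                           (#subsets-empty heads (λ { _ (() , _) })) ⟩
  #subsets (k + D) tails                           ≤⟨ #subsets-mono tails (sparse? k 0) id ⟩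
  #subsets (k + D) (sparse? k 0)                   ≤⟨ #sparse≤fib k D 0 ⟩
  fib (suc (k + 0))                                ≤⟨ fib-≤-suc (suc (k + 0)) ⟩
  fib (suc (suc k + 0))                            ∎
  where
  open ≤-Reasoning
  heads : Decidable (Sparse (suc k) {D} 0 ∘ (true ∷_))
  heads = sparse? (suc k) 0 ∘ (true ∷_)
  tails : Decidable (Sparse (suc k) {D} 0 ∘ (false ∷_))
  tails = sparse? (suc k) 0 ∘ (false ∷_)
#sparse≤fib (suc k) D (suc c) = begin
  #subsets (suc k + D) (sparse? (suc k) (suc c))   ≡⟨ #subsets-suc (sparse? (suc k) (suc c)) ⟩
  #subsets (k + D) heads + #subsets (k + D) tails  ≤⟨ +-mono-≤ (#subsets-mono heads (sparse? k c) (map₁ s≤s⁻¹))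
                                                                (#subsets-mono tails (sparse? k (suc c)) id) ⟩
  #subsets (k + D) (sparse? k c) + #subsets (k + D) (sparse? k (suc c))
                                                   ≤⟨ +-mono-≤ (#sparse≤fib k D c) (#sparse≤fib k D (suc c)) ⟩
  fib (suc (k + c)) + fib (suc (k + suc c))        ≡⟨ +-comm (fib (suc (k + c))) _ ⟩
  fib (suc (k + suc c)) + fib (suc (k + c))        ≡⟨ cong (λ j → fib (suc (k + suc c)) + fib j) (sym (+-suc k c)) ⟩
  fib (suc (suc k + suc c))                        ∎
  where
  open ≤-Reasoning
  heads : Decidable (Sparse (suc k) {D} (suc c) ∘ (true ∷_))
  heads = sparse? (suc k) (suc c) ∘ (true ∷_)
  tails : Decidable (Sparse (suc k) {D} (suc c) ∘ (false ∷_))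
  tails = sparse? (suc k) (suc c) ∘ (false ∷_)

incident⇒endpoint : ∀ {n} {v a b : Fin n} → incident v (a , b) ≡ true → v ≡ a ⊎ v ≡ b
incident⇒endpoint {v = v} {a} {b} _ with v ≟ a | v ≟ b
... | yes v≡a | _ = inj₁ v≡a
... | no _ | yes v≡b = inj₂ v≡b

non-endpoint⇒¬incident : ∀ {n} {v a b : Fin n} → v ≢ a → v ≢ b → incident v (a , b) ≡ false
non-endpoint⇒¬incident v≢a v≢b = ¬-not ([ v≢a , v≢b ] ∘ incident⇒endpoint)

incident-right : ∀ {n} (a b : Fin n) → incident b (a , b) ≡ true
incident-right a b with b ≟ b
... | yes _ = ∨-zeroʳ _
... | no b≢b = ⊥-elim (b≢b refl)

module _ {n} (v : Fin n) where

  degF-++ : ∀ {k l} (E₁ : Edges n k) (E₂ : Edges n l) (F : EdgeSubset (k + l)) →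
    degF (E₁ ++ E₂) F v ≡ degF E₁ (take k F) v + degF E₂ (drop k F) v
  degF-++ [] E₂ F = refl
  degF-++ (e ∷ E₁) E₂ (b ∷ F) =
    trans (cong (_ +_) (degF-++ E₁ E₂ F)) (sym (+-assoc (if b ∧ incident v e then 1 else 0) _ _))

  degF≡0 : ∀ {m} (E : Edges n m) F → (∀ i → incident v (lookup E i) ≡ false) → degF E F v ≡ 0
  degF≡0 [] [] _ = refl
  degF≡0 (e ∷ E) (false ∷ F) ¬inc = degF≡0 E F (¬inc ∘ suc)
  degF≡0 (e ∷ E) (true ∷ F) ¬inc =
    cong₂ (λ b d → (if b then 1 else 0) + d) (¬inc zero) (degF≡0 E F (¬inc ∘ suc))

  degF≡countᵇ : ∀ {m} (E : Edges n m) F →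
    (∀ i → incident v (lookup E i) ≡ true) → degF E F v ≡ countᵇ id F
  degF≡countᵇ [] [] _ = refl
  degF≡countᵇ (e ∷ E) (false ∷ F) inc = degF≡countᵇ E F (inc ∘ suc)
  degF≡countᵇ (e ∷ E) (true ∷ F) inc =
    cong₂ (λ b d → (if b then 1 else 0) + d) (inc zero) (degF≡countᵇ E F (inc ∘ suc))

  degF≤1 : ∀ {m} (E : Edges n m) F →
    (∀ i j → incident v (lookup E i) ≡ true → incident v (lookup E j) ≡ true → i ≡ j) → degF E F v ≤ 1
  degF≤1 [] [] _ = z≤n
  degF≤1 (e ∷ E) (false ∷ F) unique = degF≤1 E F (λ i j p q → suc-injective (unique (suc i) (suc j) p q))
  degF≤1 (e ∷ E) (true ∷ F) unique with incident v e in inc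
  ... | true  = s≤s (≤-reflexive (degF≡0 E F λ i → ¬-not λ inc′ → case unique zero (suc i) inc inc′ of λ ()))
  ... | false = degF≤1 E F (λ i j p q → suc-injective (unique (suc i) (suc j) p q))

  degF≥1 : ∀ {m} (E : Edges n m) F i →
    lookup F i ≡ true → incident v (lookup E i) ≡ true → 1 ≤ degF E F v
  degF≥1 (e ∷ E) (true ∷ F) zero _ inc =
    subst (λ b → 1 ≤ (if b then 1 else 0) + degF E F v) (sym inc) (s≤s z≤n)
  degF≥1 (e ∷ E) (b ∷ F) (suc i) chosen inc = ≤-trans (degF≥1 E F i chosen inc) (m≤n+m _ _)

lookup-map-allFin : ∀ {A : Set} {n} (f : Fin n → A) i → lookup (map f (allFin n)) i ≡ f i
lookup-map-allFin f i = trans (lookup-map i f (allFin _)) (cong f (lookup-allFin i))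

↑ʳ≢↑ˡ : ∀ m {n} (i : Fin n) (j : Fin m) → m ↑ʳ i ≢ j ↑ˡ n
↑ʳ≢↑ˡ m {n} i j eq
  with () ← trans (sym (splitAt-↑ʳ m n i)) (trans (cong (splitAt m) eq) (splitAt-↑ˡ m j n))

module _ (Δ : ℕ) where

  centerEdges leafEdges : Edges (suc (Δ + Δ)) Δ
  centerEdges = map (λ i → center Δ , mid Δ i) (allFin Δ)
  leafEdges = map (λ i → mid Δ i , leaf Δ i) (allFin Δ)

  lookup-centerEdges : ∀ j → lookup centerEdges j ≡ (center Δ , mid Δ j)
  lookup-centerEdges = lookup-map-allFin _

  lookup-leafEdges : ∀ j → lookup leafEdges j ≡ (mid Δ j , leaf Δ j)
  lookup-leafEdges = lookup-map-allFin _

  leaf≢mid : ∀ i j → leaf Δ i ≢ mid Δ j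
  leaf≢mid i j = ↑ʳ≢↑ˡ Δ i j ∘ suc-injective

  degF-center : ∀ F → degF (genStar2 Δ) F (center Δ) ≡ countᵇ id (take Δ F)
  degF-center F = begin
    degF (genStar2 Δ) F (center Δ)
      ≡⟨ degF-++ (center Δ) centerEdges leafEdges F ⟩
    degF centerEdges (take Δ F) (center Δ) + degF leafEdges (drop Δ F) (center Δ)
      ≡⟨ cong₂ _+_ (degF≡countᵇ (center Δ) centerEdges (take Δ F) (cong (incident (center Δ)) ∘ lookup-centerEdges))
                   (degF≡0 (center Δ) leafEdges (drop Δ F) (cong (incident (center Δ)) ∘ lookup-leafEdges)) ⟩
    countᵇ id (take Δ F) + 0
      ≡⟨ +-identityʳ _ ⟩
    countᵇ id (take Δ F)
      ∎
    where open ≡-Reasoning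

  degF-leaf≤1 : ∀ F i → degF (genStar2 Δ) F (leaf Δ i) ≤ 1
  degF-leaf≤1 F i = begin
    degF (genStar2 Δ) F (leaf Δ i)
      ≡⟨ degF-++ (leaf Δ i) centerEdges leafEdges F ⟩
    degF centerEdges (take Δ F) (leaf Δ i) + degF leafEdges (drop Δ F) (leaf Δ i)
      ≡⟨ cong (_+ degF leafEdges (drop Δ F) (leaf Δ i)) (degF≡0 (leaf Δ i) centerEdges (take Δ F) offCenterEdges) ⟩
    degF leafEdges (drop Δ F) (leaf Δ i)
      ≤⟨ degF≤1 (leaf Δ i) leafEdges (drop Δ F) onlyOwnEdge ⟩
    1
      ∎
    where
    open ≤-Reasoning
    offCenterEdges : ∀ j → incident (leaf Δ i) (lookup centerEdges j) ≡ false
    offCenterEdges j = trans (cong (incident (leaf Δ i)) (lookup-centerEdges j))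
                             (non-endpoint⇒¬incident {a = center Δ} (λ ()) (leaf≢mid i j))
    onLeafEdge⇒same : ∀ j → incident (leaf Δ i) (lookup leafEdges j) ≡ true → i ≡ j
    onLeafEdge⇒same j on =
      [ ⊥-elim ∘ leaf≢mid i j , ↑ʳ-injective Δ i j ∘ suc-injective ]
        (incident⇒endpoint (trans (cong (incident (leaf Δ i)) (sym (lookup-leafEdges j))) on))
    onlyOwnEdge : ∀ j j′ → incident (leaf Δ i) (lookup leafEdges j) ≡ true →
      incident (leaf Δ i) (lookup leafEdges j′) ≡ true → j ≡ j′
    onlyOwnEdge j j′ p q = trans (sym (onLeafEdge⇒same j p)) (onLeafEdge⇒same j′ q)

  leafEdge-chosen⇒degF≥1 : ∀ F i → lookup F (Δ ↑ʳ i) ≡ true → 1 ≤ degF (genStar2 Δ) F (leaf Δ i)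
  leafEdge-chosen⇒degF≥1 F i chosen =
    degF≥1 (leaf Δ i) (genStar2 Δ) F (Δ ↑ʳ i) chosen onOwnEdge
    where
    onOwnEdge : incident (leaf Δ i) (lookup (genStar2 Δ) (Δ ↑ʳ i)) ≡ true
    onOwnEdge = begin
      incident (leaf Δ i) (lookup (genStar2 Δ) (Δ ↑ʳ i))
        ≡⟨ cong (incident (leaf Δ i)) (lookup-++ʳ centerEdges leafEdges i) ⟩
      incident (leaf Δ i) (lookup leafEdges i)
        ≡⟨ cong (incident (leaf Δ i)) (lookup-leafEdges i) ⟩
      incident (leaf Δ i) (mid Δ i , leaf Δ i)
        ≡⟨ incident-right (mid Δ i) (leaf Δ i) ⟩
      true
        ∎
      where open ≡-Reasoning

double≤⇒≤half : ∀ {m n} → 2 * m ≤ n → m ≤ ⌊ n /2⌋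
double≤⇒≤half {m} {n} 2m≤n = begin
  m              ≡⟨ n≡⌊n+n/2⌋ m ⟩
  ⌊ m + m /2⌋    ≤⟨ ⌊n/2⌋-mono (subst (_≤ n) (cong (m +_) (+-identityʳ m)) 2m≤n) ⟩
  ⌊ n /2⌋        ∎
  where open ≤-Reasoning

fix⇒sparse : ∀ Δ {F} → IsFix (genStar2 Δ) F → Sparse Δ ⌊ Δ /2⌋ F
fix⇒sparse Δ {F} fix = double≤⇒≤half centerBound , noLeafEdge
  where
  centerBound : 2 * countᵇ id (take Δ F) ≤ Δ
  centerBound = begin
    2 * countᵇ id (take Δ F)              ≡⟨ cong (2 *_) (degF-center Δ F) ⟨
    2 * degF (genStar2 Δ) F (center Δ)   ≤⟨ fix (center Δ) ⟩
    deg (genStar2 Δ) (center Δ)          ≡⟨ degF-center Δ (full (Δ + Δ)) ⟩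
    countᵇ id (take Δ (full (Δ + Δ)))    ≤⟨ count≤n (T? ∘ id) (take Δ (full (Δ + Δ))) ⟩
    Δ                                    ∎
    where open ≤-Reasoning
  noLeafEdge : ∀ i → lookup F (Δ ↑ʳ i) ≡ false
  noLeafEdge i = ¬-not λ chosen → case
    ≤-trans (*-monoʳ-≤ 2 (leafEdge-chosen⇒degF≥1 Δ F i chosen))
            (≤-trans (fix (leaf Δ i)) (degF-leaf≤1 Δ (full (Δ + Δ)) i)) of λ { (s≤s ()) }

2Δ+1∸⌈Δ/2⌉ : ∀ Δ → 2 * Δ + 1 ∸ ⌈ Δ /2⌉ ≡ suc (Δ + ⌊ Δ /2⌋)
2Δ+1∸⌈Δ/2⌉ Δ = begin
  2 * Δ + 1 ∸ u                  ≡⟨ cong (λ x → 2 * x + 1 ∸ u) (⌊n/2⌋+⌈n/2⌉≡n Δ) ⟨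
  2 * (h + u) + 1 ∸ u            ≡⟨ cong (_∸ u) (regroup h u) ⟩
  suc (h + u + h) + u ∸ u        ≡⟨ m+n∸n≡m _ u ⟩
  suc (h + u + h)                ≡⟨ cong (λ x → suc (x + h)) (⌊n/2⌋+⌈n/2⌉≡n Δ) ⟩
  suc (Δ + h)                    ∎
  where
  open ≡-Reasoning
  h = ⌊ Δ /2⌋
  u = ⌈ Δ /2⌉
  regroup : ∀ h u → 2 * (h + u) + 1 ≡ suc (h + u + h) + u
  regroup = solve-∀

lemma6 : (Δ n : ℕ) → n ≡ 2 * Δ + 1 →
    numFix (genStar2 Δ) ≤ fib (n ∸ ⌈ Δ /2⌉)
lemma6 Δ n refl = begin
  numFix (genStar2 Δ)
    ≤⟨ #subsets-mono (isFix? (genStar2 Δ)) (sparse? Δ ⌊ Δ /2⌋) (fix⇒sparse Δ) ⟩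
  #subsets (Δ + Δ) (sparse? Δ ⌊ Δ /2⌋)
    ≤⟨ #sparse≤fib Δ Δ ⌊ Δ /2⌋ ⟩
  fib (suc (Δ + ⌊ Δ /2⌋))
    ≡⟨ cong fib (2Δ+1∸⌈Δ/2⌉ Δ) ⟨
  fib (2 * Δ + 1 ∸ ⌈ Δ /2⌉)
    ∎
  where open ≤-Reasoning
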